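{- Let $n$ be a positive integer and $\mathrm{TH}_m=\binom{m+2}{3}$. The sequence $(\mathrm{TH}_{n+3},\mathrm{TH}_{n+2},\mathrm{TH}_{n+1},\mathrm{TH}_n)$ is telescopic if and only if $n\equiv r \pmod 6$ with $r\in\{4,5\}$.
   Context: Let $(a_1,\ldots,a_k)$ ($k\ge2$) be a sequence of positive integers with $\gcd\{a_1,\ldots,a_k\}=1$, and let $d_i=\gcd\{a_1,\ldots,a_i\}$ for $i=1,\ldots,k$. The sequence is telescopic if, for every $i=2,\ldots,k$, the integer $a_i/d_i$ is a non-negative integer linear combination of $a_1/d_{i-1},\ldots,a_{i-1}/d_{i-1}$. -}

module Defs where

open import Data.Nat using (ℕ; zero; suc; _+_; _*_; _/_; _≤_; _<_; _∸_)
open import Relation.Binary.PropositionalEquality using (_≡_)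
open import Data.Nat.GCD using (gcd)
open import Data.Nat.Combinatorics using (_C_)
open import Data.Fin as F using (Fin)
open import Data.Vec using (Vec; []; _∷_; lookup)
open import Data.Product using (Σ; ∃; _×_)

TH : ℕ → ℕ
TH m = (m + 2) C 3

-- d i = gcd of the first i entries a_1 ... a_i (a 0-indexed function; i ≥ 1)
prefixGcd : ∀ {k} → (Fin k → ℕ) → ℕ → ℕ
prefixGcd {zero}  a i       = 0
prefixGcd {suc k} a zero    = 0
prefixGcd {suc k} a (suc i) = gcd (a F.zero) (prefixGcd (λ j → a (F.suc j)) i)

-- exact division; only ever used with a positive divisor (the d_i are
-- positive when all entries are positive), the 0 case is a dummy value.
_÷_ : ℕ → ℕ → ℕ
m ÷ zero  = 0
m ÷ suc d = m / suc d

sumBelow : ℕ → (ℕ → ℕ) → ℕ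
sumBelow zero    f = 0
sumBelow (suc i) f = sumBelow i f + f i

-- read a function on Fin k as a function on ℕ (0 outside the range)
at : ∀ {k} → (Fin k → ℕ) → ℕ → ℕ
at {zero}  a i       = 0
at {suc k} a zero    = a F.zero
at {suc k} a (suc i) = at (λ j → a (F.suc j)) i

-- Telescopic (paper's definition, 1-indexed there; here entry a_{i+1} is at i).
Telescopic : ∀ {k} → (Fin k → ℕ) → Set
Telescopic {k} a =
  (2 ≤ k) × ((j : Fin k) → 1 ≤ a j) × (prefixGcd a k ≡ 1) ×
  ((i : ℕ) → 2 ≤ i → i ≤ k →
     Σ (ℕ → ℕ) λ c →
       at a (i ∸ 1) ÷ prefixGcd a i
         ≡ sumBelow (i ∸ 1) (λ j → c j * (at a j ÷ prefixGcd a (i ∸ 1))))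

seq4 : ℕ → ℕ → ℕ → ℕ → Fin 4 → ℕ
seq4 x y z w i = lookup (x ∷ y ∷ z ∷ w ∷ []) i

-- TH(n + 3) and TH(n + 2) share the factor (n + 3)(n + 4)/6, so on each residue class n = r + 6q
-- the prefix gcds d₂ and d₃ are explicit polynomials in q, certified by Bézout identities, while
-- d₄ = 1 because the third difference of TH is 1. Telescopicity thus amounts to two memberships in
-- numerical semigroups with explicit generators. For r = 4, 5 explicit combinations exist. For
-- r = 0, 2 the third term is an odd multiple h(1 + 2t) of h for generators 3 + 2h and 2h, which is
-- impossible when 3 ∤ h. For r = 1, 3 two of the generators vanish modulo n + 4 while TH n ≡ −4, and
-- the coefficient of the third generator is too small to make up the difference.
module Submission where

open import Defs
open import Data.Nat using (ℕ; zero; suc; _+_; _*_; _∸_; _%_; _≤_; _<_; z≤n; s≤s; z<s; >-nonZero)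
open import Data.Nat.Properties
open import Data.Nat.Combinatorics using (_C_; nC1≡n; nCk+nC[k+1]≡[n+1]C[k+1])
open import Data.Nat.DivMod using (DivMod; result; _divMod_; [m+kn]%n≡m%n; m<n⇒m%n≡m; m*n/n≡m; n/1≡n)
open import Data.Nat.Divisibility
  using (_∣_; divides; _∣0; ∣-trans; ∣-refl; n∣m*n; m∣m*n; >⇒∤; ∣m∣n⇒∣m+n; ∣m+n∣m⇒∣n; ∣n⇒∣m*n; ∣1⇒≡1)
open import Data.Nat.GCD using (gcd; gcd[m,n]∣m; gcd[m,n]∣n; gcd-identityʳ; gcd-assoc; c*gcd[m,n]≡gcd[cm,cn]; module Bézout)
open import Data.Nat.Coprimality using (Coprime; coprime⇒gcd≡1; coprime-divisor)
open import Data.Nat.Tactic.RingSolver using (solve; solve-∀)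
open import Data.Fin as F using (Fin)
open import Data.List using ([]; _∷_)
open import Data.Product using (Σ; _,_; _×_; ∃₂; proj₁; proj₂)
open import Data.Sum using (_⊎_; inj₁; inj₂)
open import Data.Empty using (⊥; ⊥-elim)
open import Function.Bundles using (_⇔_; mk⇔; Equivalence)
open import Relation.Nullary using (¬_; contradiction)
open import Relation.Binary.PropositionalEquality
  using (_≡_; _≢_; refl; sym; trans; cong; cong₂; subst; subst₂; module ≡-Reasoning)

open ≡-Reasoning

2*[1+n]C2≡[1+n]*n : ∀ n → 2 * (suc n C 2) ≡ suc n * n
2*[1+n]C2≡[1+n]*n zero    = refl
2*[1+n]C2≡[1+n]*n (suc n) = begin
  2 * (suc (suc n) C 2)        ≡⟨ cong (2 *_) (nCk+nC[k+1]≡[n+1]C[k+1] (suc n) 1) ⟨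
  2 * (suc n C 1 + suc n C 2)  ≡⟨ cong (λ c → 2 * (c + suc n C 2)) (nC1≡n (suc n)) ⟩
  2 * (suc n + suc n C 2)      ≡⟨ *-distribˡ-+ 2 (suc n) (suc n C 2) ⟩
  2 * suc n + 2 * (suc n C 2)  ≡⟨ cong (2 * suc n +_) (2*[1+n]C2≡[1+n]*n n) ⟩
  2 * suc n + suc n * n        ≡⟨ solve (n ∷ []) ⟩
  suc (suc n) * suc n          ∎

6*[2+n]C3≡[2+n]*[1+n]*n : ∀ n → 6 * (suc (suc n) C 3) ≡ suc (suc n) * suc n * n
6*[2+n]C3≡[2+n]*[1+n]*n zero    = refl
6*[2+n]C3≡[2+n]*[1+n]*n (suc n) = begin
  6 * (suc (suc (suc n)) C 3)                        ≡⟨ cong (6 *_) (nCk+nC[k+1]≡[n+1]C[k+1] (suc (suc n)) 2) ⟨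
  6 * (suc (suc n) C 2 + suc (suc n) C 3)            ≡⟨ *-distribˡ-+ 6 (suc (suc n) C 2) _ ⟩
  6 * (suc (suc n) C 2) + 6 * (suc (suc n) C 3)      ≡⟨ cong (_+ 6 * (suc (suc n) C 3)) (*-assoc 3 2 (suc (suc n) C 2)) ⟩
  3 * (2 * (suc (suc n) C 2)) + 6 * (suc (suc n) C 3)
    ≡⟨ cong₂ (λ x y → 3 * x + y) (2*[1+n]C2≡[1+n]*n (suc n)) (6*[2+n]C3≡[2+n]*[1+n]*n n) ⟩
  3 * (suc (suc n) * suc n) + suc (suc n) * suc n * n ≡⟨ solve (n ∷ []) ⟩
  suc (suc (suc n)) * suc (suc n) * suc n            ∎

TH-closed-form : ∀ m → 6 * TH m ≡ m * (m + 1) * (m + 2)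
TH-closed-form m = begin
  6 * ((m + 2) C 3)            ≡⟨ cong (λ k → 6 * (k C 3)) (+-comm m 2) ⟩
  6 * (suc (suc m) C 3)        ≡⟨ 6*[2+n]C3≡[2+n]*[1+n]*n m ⟩
  suc (suc m) * suc m * m      ≡⟨ solve (m ∷ []) ⟩
  m * (m + 1) * (m + 2)        ∎

TH-by-closed-form : ∀ m {p} → m * (m + 1) * (m + 2) ≡ 6 * p → TH m ≡ p
TH-by-closed-form m {p} eq = *-cancelˡ-≡ (TH m) p 6 (trans (TH-closed-form m) eq)

TH-positive : ∀ m → 1 ≤ m → 1 ≤ TH m
TH-positive (suc k) _ = n≢0⇒n>0 λ TH≡0 → 0≢1+n (trans (cong (6 *_) (sym TH≡0)) (TH-closed-form (suc k)))

TH-third-difference : ∀ n → TH (n + 3) + 3 * TH (n + 1) ≡ 3 * TH (n + 2) + TH n + 1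
TH-third-difference n = *-cancelˡ-≡ _ _ 6 (begin
  6 * (TH (n + 3) + 3 * TH (n + 1))                ≡⟨ expand (TH (n + 3)) (TH (n + 1)) ⟩
  6 * TH (n + 3) + 3 * (6 * TH (n + 1))            ≡⟨ cong₂ (λ x y → x + 3 * y) (TH-closed-form (n + 3)) (TH-closed-form (n + 1)) ⟩
  (n + 3) * (n + 3 + 1) * (n + 3 + 2) + 3 * ((n + 1) * (n + 1 + 1) * (n + 1 + 2))
                                                   ≡⟨ solve (n ∷ []) ⟩
  3 * ((n + 2) * (n + 2 + 1) * (n + 2 + 2)) + n * (n + 1) * (n + 2) + 6
                                                   ≡⟨ cong₂ (λ x y → 3 * x + y + 6) (TH-closed-form (n + 2)) (TH-closed-form n) ⟨
  3 * (6 * TH (n + 2)) + 6 * TH n + 6              ≡⟨ collect (TH (n + 2)) (TH n) ⟩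
  6 * (3 * TH (n + 2) + TH n + 1)                  ∎)
  where
    -- stated for abstract x and y, since the solver would unfold TH
    expand : ∀ x y → 6 * (x + 3 * y) ≡ 6 * x + 3 * (6 * y)
    expand = solve-∀
    collect : ∀ x y → 3 * (6 * x) + 6 * y + 6 ≡ 6 * (3 * x + y + 1)
    collect = solve-∀

consecutiveTH : ℕ → Fin 4 → ℕ
consecutiveTH n = seq4 (TH (n + 3)) (TH (n + 2)) (TH (n + 1)) (TH n)

consecutiveTH-positive : ∀ n → 1 ≤ n → (j : Fin 4) → 1 ≤ consecutiveTH n j
consecutiveTH-positive n 1≤n F.zero                      = TH-positive (n + 3) (≤-trans 1≤n (m≤m+n n 3))
consecutiveTH-positive n 1≤n (F.suc F.zero)               = TH-positive (n + 2) (≤-trans 1≤n (m≤m+n n 2))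
consecutiveTH-positive n 1≤n (F.suc (F.suc F.zero))       = TH-positive (n + 1) (≤-trans 1≤n (m≤m+n n 1))
consecutiveTH-positive n 1≤n (F.suc (F.suc (F.suc F.zero))) = TH-positive n 1≤n

consecutiveTH-coprime : ∀ n → prefixGcd (consecutiveTH n) 4 ≡ 1
consecutiveTH-coprime n = coprime⇒gcd≡1 common-divisor≡1
  where
    a₁ = TH (n + 3); a₂ = TH (n + 2); a₃ = TH (n + 1); a₄ = TH n
    common-divisor≡1 : ∀ {d} → d ∣ a₁ × d ∣ gcd a₂ (gcd a₃ (gcd a₄ 0)) → d ≡ 1
    common-divisor≡1 {d} (d∣a₁ , d∣rest) = ∣1⇒≡1 (∣m+n∣m⇒∣n d∣3a₂+a₄+1 d∣3a₂+a₄)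
      where
        d∣a₂ : d ∣ a₂
        d∣a₂ = ∣-trans d∣rest (gcd[m,n]∣m a₂ _)
        d∣a₃ : d ∣ a₃
        d∣a₃ = ∣-trans d∣rest (∣-trans (gcd[m,n]∣n a₂ _) (gcd[m,n]∣m a₃ _))
        d∣a₄ : d ∣ a₄
        d∣a₄ = ∣-trans d∣rest (∣-trans (gcd[m,n]∣n a₂ _) (∣-trans (gcd[m,n]∣n a₃ _) (gcd[m,n]∣m a₄ 0)))
        d∣3a₂+a₄ : d ∣ 3 * a₂ + a₄
        d∣3a₂+a₄ = ∣m∣n⇒∣m+n (∣n⇒∣m*n 3 d∣a₂) d∣a₄
        d∣3a₂+a₄+1 : d ∣ 3 * a₂ + a₄ + 1
        d∣3a₂+a₄+1 = subst (d ∣_) (TH-third-difference n) (∣m∣n⇒∣m+n d∣a₁ (∣n⇒∣m*n 3 d∣a₃))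

Bézout⇒coprime : ∀ {m n} → Bézout.Identity 1 m n → Coprime m n
Bézout⇒coprime {m} {n} (Bézout.+- x y eq) {d} (d∣m , d∣n) =
  ∣1⇒≡1 (∣m+n∣m⇒∣n (subst (d ∣_) (trans (sym eq) (+-comm 1 (y * n))) (∣n⇒∣m*n x d∣m)) (∣n⇒∣m*n y d∣n))
Bézout⇒coprime {m} {n} (Bézout.-+ x y eq) {d} (d∣m , d∣n) =
  ∣1⇒≡1 (∣m+n∣m⇒∣n (subst (d ∣_) (trans (sym eq) (+-comm 1 (x * m))) (∣n⇒∣m*n y d∣n)) (∣n⇒∣m*n x d∣m))

coprime⇒gcd[m*d,n*d]≡d : ∀ {m n} d → Coprime m n → gcd (m * d) (n * d) ≡ d
coprime⇒gcd[m*d,n*d]≡d {m} {n} d m⊥n = begin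
  gcd (m * d) (n * d)  ≡⟨ cong₂ gcd (*-comm m d) (*-comm n d) ⟩
  gcd (d * m) (d * n)  ≡⟨ c*gcd[m,n]≡gcd[cm,cn] d m n ⟨
  d * gcd m n          ≡⟨ cong (d *_) (coprime⇒gcd≡1 m⊥n) ⟩
  d * 1                ≡⟨ *-identityʳ d ⟩
  d                    ∎

m≡q*d⇒m÷d≡q : ∀ {m} q d → 1 ≤ m → m ≡ q * d → m ÷ d ≡ q
m≡q*d⇒m÷d≡q q zero    1≤m m≡q*0 = ⊥-elim (<⇒≢ 1≤m (sym (trans m≡q*0 (*-zeroʳ q))))
m≡q*d⇒m÷d≡q q (suc d) _   refl  = m*n/n≡m q (suc d)

infix 4 _∈ℕ_+ℕ_ _∈ℕ_+ℕ_+ℕ_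

_∈ℕ_+ℕ_ : ℕ → ℕ → ℕ → Set
t ∈ℕ g₁ +ℕ g₂ = ∃₂ λ x y → t ≡ x * g₁ + y * g₂

_∈ℕ_+ℕ_+ℕ_ : ℕ → ℕ → ℕ → ℕ → Set
t ∈ℕ g₁ +ℕ g₂ +ℕ g₃ = ∃₂ λ x y → Σ ℕ λ z → t ≡ x * g₁ + y * g₂ + z * g₃

-- From h ∣ 3y we get y = w h; cancelling h leaves 1 + 2t = w (3 + 2h) + 2z, so w is odd and too large.
h*[1+2t]∉ℕ[3+2h]+ℕ[2h] : ∀ h t → Coprime h 3 → t ≤ h → ¬ (h * (1 + 2 * t) ∈ℕ 3 + 2 * h +ℕ 2 * h)
h*[1+2t]∉ℕ[3+2h]+ℕ[2h] zero t 0⊥3 _ _ = contradiction (0⊥3 (3 ∣0 , ∣-refl)) λ ()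
h*[1+2t]∉ℕ[3+2h]+ℕ[2h] h@(suc _) t h⊥3 t≤h (y , z , eq) = ¬h∣y (coprime-divisor {o = y} h⊥3 h∣3y)
  where
    split-3y : ∀ h y z → y * (3 + 2 * h) + z * (2 * h) ≡ h * (2 * (y + z)) + 3 * y
    split-3y = solve-∀
    factor-h : ∀ w h z → w * h * (3 + 2 * h) + z * (2 * h) ≡ h * (w * (3 + 2 * h) + 2 * z)
    factor-h = solve-∀

    h∣3y : h ∣ 3 * y
    h∣3y = ∣m+n∣m⇒∣n (subst (h ∣_) (trans eq (split-3y h y z)) (m∣m*n (1 + 2 * t))) (m∣m*n (2 * (y + z)))

    1+2t≢w*[3+2h]+2z : ∀ w → 1 + 2 * t ≢ w * (3 + 2 * h) + 2 * z
    1+2t≢w*[3+2h]+2z zero    odd≡even = even≢odd z t (sym odd≡even)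
    1+2t≢w*[3+2h]+2z (suc w) odd≡big  = <⇒≱ 1+2t<3+2h 3+2h≤1+2t
      where
        1+2t<3+2h : 1 + 2 * t < 3 + 2 * h
        1+2t<3+2h = ≤-<-trans (+-monoʳ-≤ 1 (*-monoʳ-≤ 2 t≤h)) (+-monoˡ-< (2 * h) {1} {3} (s≤s (s≤s z≤n)))
        3+2h≤1+2t : 3 + 2 * h ≤ 1 + 2 * t
        3+2h≤1+2t = subst (3 + 2 * h ≤_) (sym odd≡big) (≤-trans (m≤m+n _ (w * (3 + 2 * h))) (m≤m+n _ (2 * z)))

    ¬h∣y : h ∣ y → ⊥
    ¬h∣y (divides w y≡w*h) = 1+2t≢w*[3+2h]+2z w (*-cancelˡ-≡ _ _ h (begin
      h * (1 + 2 * t)                    ≡⟨ eq ⟩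
      y * (3 + 2 * h) + z * (2 * h)      ≡⟨ cong (λ y → y * (3 + 2 * h) + z * (2 * h)) y≡w*h ⟩
      w * h * (3 + 2 * h) + z * (2 * h)  ≡⟨ factor-h w h z ⟩
      h * (w * (3 + 2 * h) + 2 * z)      ∎))

∉ℕ+ℕ+ℕ-by-residue : ∀ M {g₁ g₂ g₃ t} c k b u → M ∣ g₁ → M ∣ g₂ → g₃ ≡ c + u * M → M ∣ t + k →
                    t < suc b * g₃ → 1 ≤ k → b * c + k < M → ¬ (t ∈ℕ g₁ +ℕ g₂ +ℕ g₃)
∉ℕ+ℕ+ℕ-by-residue M {g₁} {g₂} c k b u M∣g₁ M∣g₂ refl M∣t+k t<[1+b]g₃ 1≤k bc+k<M (x , y , z , refl) =
  >⇒∤ {{>-nonZero 0<zc+k}} zc+k<M M∣zc+k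
  where
    0<zc+k : 0 < z * c + k
    0<zc+k = ≤-trans 1≤k (m≤n+m k (z * c))
    z≤b : z ≤ b
    z≤b = ≤-pred (*-cancelʳ-< (c + u * M) z (suc b) (≤-<-trans (m≤n+m _ (x * g₁ + y * g₂)) t<[1+b]g₃))
    zc+k<M : z * c + k < M
    zc+k<M = ≤-<-trans (+-monoˡ-≤ k (*-monoˡ-≤ c z≤b)) bc+k<M
    regroup : ∀ x g₁ y g₂ z c u M k →
      x * g₁ + y * g₂ + z * (c + u * M) + k ≡ (x * g₁ + y * g₂ + z * u * M) + (z * c + k)
    regroup = solve-∀
    M∣zc+k : M ∣ z * c + k
    M∣zc+k = ∣m+n∣m⇒∣n (subst (M ∣_) (regroup x g₁ y g₂ z c u M k) M∣t+k)
      (∣m∣n⇒∣m+n (∣m∣n⇒∣m+n (∣n⇒∣m*n x M∣g₁) (∣n⇒∣m*n y M∣g₂)) (n∣m*n (z * u)))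

x*[y*z]≡y*x*z : ∀ x y z → x * (y * z) ≡ y * x * z
x*[y*z]≡y*x*z = solve-∀

combination₃-cong : ∀ x y z {u u′ v v′ w w′} → u ≡ u′ → v ≡ v′ → w ≡ w′ →
                    x * u + y * v + z * w ≡ x * u′ + y * v′ + z * w′
combination₃-cong x y z refl refl refl = refl

-- d₂ = e * d₃ and d₃ are the prefix gcds of (a₁, a₂, a₃); b₁, b₂, b₃ are a₁ / d₂, a₂ / d₂, a₃ / d₃.
record PrefixGcdFactorisation (a₁ a₂ a₃ : ℕ) : Set where
  field
    b₁ b₂ b₃ e d₃ : ℕ
    a₁≡ : a₁ ≡ b₁ * (e * d₃)
    a₂≡ : a₂ ≡ b₂ * (e * d₃)
    a₃≡ : a₃ ≡ b₃ * d₃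
    b₁⊥b₂ : Bézout.Identity 1 b₁ b₂
    e⊥b₃ : Bézout.Identity 1 e b₃

module _ {a₁ a₂ a₃ a₄ : ℕ} (F : PrefixGcdFactorisation a₁ a₂ a₃) where
  open PrefixGcdFactorisation F

  private
    a : Fin 4 → ℕ
    a = seq4 a₁ a₂ a₃ a₄

  gcd[a₁,a₂]≡ : gcd a₁ a₂ ≡ e * d₃
  gcd[a₁,a₂]≡ = trans (cong₂ gcd a₁≡ a₂≡) (coprime⇒gcd[m*d,n*d]≡d (e * d₃) (Bézout⇒coprime b₁⊥b₂))

  prefixGcd₂≡ : prefixGcd a 2 ≡ e * d₃
  prefixGcd₂≡ = trans (cong (gcd a₁) (gcd-identityʳ a₂)) gcd[a₁,a₂]≡

  prefixGcd₃≡ : prefixGcd a 3 ≡ d₃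
  prefixGcd₃≡ = begin
    gcd a₁ (gcd a₂ (gcd a₃ 0))  ≡⟨ cong (λ g → gcd a₁ (gcd a₂ g)) (gcd-identityʳ a₃) ⟩
    gcd a₁ (gcd a₂ a₃)          ≡⟨ gcd-assoc a₁ a₂ a₃ ⟨
    gcd (gcd a₁ a₂) a₃          ≡⟨ cong₂ gcd gcd[a₁,a₂]≡ a₃≡ ⟩
    gcd (e * d₃) (b₃ * d₃)      ≡⟨ coprime⇒gcd[m*d,n*d]≡d d₃ (Bézout⇒coprime e⊥b₃) ⟩
    d₃                          ∎

  module _ (positive : ∀ j → 1 ≤ a j) where
    a₁/d₁≡1 : a₁ ÷ prefixGcd a 1 ≡ 1
    a₁/d₁≡1 = trans (cong (a₁ ÷_) (gcd-identityʳ a₁)) (m≡q*d⇒m÷d≡q 1 a₁ (positive F.zero) (sym (*-identityˡ a₁)))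

    a₁/d₂≡b₁ : a₁ ÷ prefixGcd a 2 ≡ b₁
    a₁/d₂≡b₁ = trans (cong (a₁ ÷_) prefixGcd₂≡) (m≡q*d⇒m÷d≡q b₁ _ (positive F.zero) a₁≡)

    a₂/d₂≡b₂ : a₂ ÷ prefixGcd a 2 ≡ b₂
    a₂/d₂≡b₂ = trans (cong (a₂ ÷_) prefixGcd₂≡) (m≡q*d⇒m÷d≡q b₂ _ (positive (F.suc F.zero)) a₂≡)

    a₃/d₃≡b₃ : a₃ ÷ prefixGcd a 3 ≡ b₃
    a₃/d₃≡b₃ = trans (cong (a₃ ÷_) prefixGcd₃≡) (m≡q*d⇒m÷d≡q b₃ d₃ (positive (F.suc (F.suc F.zero))) a₃≡)

    a₁/d₃≡e*b₁ : a₁ ÷ prefixGcd a 3 ≡ e * b₁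
    a₁/d₃≡e*b₁ = trans (cong (a₁ ÷_) prefixGcd₃≡)
      (m≡q*d⇒m÷d≡q (e * b₁) d₃ (positive F.zero) (trans a₁≡ (x*[y*z]≡y*x*z b₁ e d₃)))

    a₂/d₃≡e*b₂ : a₂ ÷ prefixGcd a 3 ≡ e * b₂
    a₂/d₃≡e*b₂ = trans (cong (a₂ ÷_) prefixGcd₃≡)
      (m≡q*d⇒m÷d≡q (e * b₂) d₃ (positive (F.suc F.zero)) (trans a₂≡ (x*[y*z]≡y*x*z b₂ e d₃)))

    a₄/d₄≡a₄ : prefixGcd a 4 ≡ 1 → a₄ ÷ prefixGcd a 4 ≡ a₄
    a₄/d₄≡a₄ d₄≡1 = trans (cong (a₄ ÷_) d₄≡1) (n/1≡n a₄)

    step₃⇔ : ∀ x y → a₃ ÷ prefixGcd a 3 ≡ x * (a₁ ÷ prefixGcd a 2) + y * (a₂ ÷ prefixGcd a 2)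
                    ⇔ b₃ ≡ x * b₁ + y * b₂
    step₃⇔ x y = mk⇔
      (λ eq → trans (sym a₃/d₃≡b₃) (trans eq quotients≡))
      (λ eq → trans a₃/d₃≡b₃ (trans eq (sym quotients≡)))
      where
        quotients≡ : x * (a₁ ÷ prefixGcd a 2) + y * (a₂ ÷ prefixGcd a 2) ≡ x * b₁ + y * b₂
        quotients≡ = cong₂ (λ u v → x * u + y * v) a₁/d₂≡b₁ a₂/d₂≡b₂

    step₄⇔ : prefixGcd a 4 ≡ 1 → ∀ x y z →
             a₄ ÷ prefixGcd a 4 ≡ x * (a₁ ÷ prefixGcd a 3) + y * (a₂ ÷ prefixGcd a 3) + z * (a₃ ÷ prefixGcd a 3)
             ⇔ a₄ ≡ x * (e * b₁) + y * (e * b₂) + z * b₃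
    step₄⇔ d₄≡1 x y z = mk⇔
      (λ eq → trans (sym (a₄/d₄≡a₄ d₄≡1)) (trans eq quotients≡))
      (λ eq → trans (a₄/d₄≡a₄ d₄≡1) (trans eq (sym quotients≡)))
      where
        quotients≡ : x * (a₁ ÷ prefixGcd a 3) + y * (a₂ ÷ prefixGcd a 3) + z * (a₃ ÷ prefixGcd a 3)
                     ≡ x * (e * b₁) + y * (e * b₂) + z * b₃
        quotients≡ = combination₃-cong x y z a₁/d₃≡e*b₁ a₂/d₃≡e*b₂ a₃/d₃≡b₃

    telescopic⇔ : prefixGcd a 4 ≡ 1 →
                  Telescopic a ⇔ ((b₃ ∈ℕ b₁ +ℕ b₂) × (a₄ ∈ℕ e * b₁ +ℕ e * b₂ +ℕ b₃))
    telescopic⇔ d₄≡1 = mk⇔ to from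
      where
        to : Telescopic a → (b₃ ∈ℕ b₁ +ℕ b₂) × (a₄ ∈ℕ e * b₁ +ℕ e * b₂ +ℕ b₃)
        to (_ , _ , _ , step) =
          let c , eq₃ = step 3 (s≤s (s≤s z≤n)) (s≤s (s≤s (s≤s z≤n)))
              c′ , eq₄ = step 4 (s≤s (s≤s z≤n)) (s≤s (s≤s (s≤s (s≤s z≤n))))
          in (c 0 , c 1 , Equivalence.to (step₃⇔ (c 0) (c 1)) eq₃) ,
             (c′ 0 , c′ 1 , c′ 2 , Equivalence.to (step₄⇔ d₄≡1 (c′ 0) (c′ 1) (c′ 2)) eq₄)

        from : (b₃ ∈ℕ b₁ +ℕ b₂) × (a₄ ∈ℕ e * b₁ +ℕ e * b₂ +ℕ b₃) → Telescopic a
        from ((x , y , b₃≡) , (x′ , y′ , z′ , a₄≡)) = s≤s (s≤s z≤n) , positive , d₄≡1 , step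
          where
            step : (i : ℕ) → 2 ≤ i → i ≤ 4 → Σ (ℕ → ℕ) λ c →
              at a (i ∸ 1) ÷ prefixGcd a i ≡ sumBelow (i ∸ 1) (λ j → c j * (at a j ÷ prefixGcd a (i ∸ 1)))
            step 1 (s≤s ()) _
            step 2 _ _ = (λ _ → a₂ ÷ prefixGcd a 2) ,
              sym (trans (cong (a₂ ÷ prefixGcd a 2 *_) a₁/d₁≡1) (*-identityʳ _))
            step 3 _ _ = (λ { 0 → x ; _ → y }) , Equivalence.from (step₃⇔ x y) b₃≡
            step 4 _ _ = (λ { 0 → x′ ; 1 → y′ ; _ → z′ }) , Equivalence.from (step₄⇔ d₄≡1 x′ y′ z′) a₄≡
            step (suc (suc (suc (suc (suc _))))) _ (s≤s (s≤s (s≤s (s≤s ()))))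

consecutiveTH-telescopic⇔ : ∀ n → 1 ≤ n → (F : PrefixGcdFactorisation (TH (n + 3)) (TH (n + 2)) (TH (n + 1))) →
  let open PrefixGcdFactorisation F in
  Telescopic (consecutiveTH n) ⇔ ((b₃ ∈ℕ b₁ +ℕ b₂) × (TH n ∈ℕ e * b₁ +ℕ e * b₂ +ℕ b₃))
consecutiveTH-telescopic⇔ n 1≤n F = telescopic⇔ F (consecutiveTH-positive n 1≤n) (consecutiveTH-coprime n)

consecutiveTH-telescopic-4 : ∀ q → Telescopic (consecutiveTH (4 + q * 6))
consecutiveTH-telescopic-4 q = Equivalence.from (consecutiveTH-telescopic⇔ (4 + q * 6) (s≤s z≤n) F)
  ((1 + q , 1 + 2 * q , b₃-combination) , (0 , 0 , 4 + 6 * q , a₄-combination))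
  where
    F : PrefixGcdFactorisation (TH (4 + q * 6 + 3)) (TH (4 + q * 6 + 2)) (TH (4 + q * 6 + 1))
    F = record
      { b₁ = 3 + 2 * q ; b₂ = 2 + 2 * q ; b₃ = (1 + q) * (5 + 6 * q) ; e = 4 + 3 * q ; d₃ = 7 + 6 * q
      ; a₁≡ = TH-by-closed-form (4 + q * 6 + 3) (solve (q ∷ []))
      ; a₂≡ = TH-by-closed-form (4 + q * 6 + 2) (solve (q ∷ []))
      ; a₃≡ = TH-by-closed-form (4 + q * 6 + 1) (solve (q ∷ []))
      ; b₁⊥b₂ = Bézout.+- 1 1 (solve (q ∷ []))
      ; e⊥b₃ = Bézout.-+ (1 + 2 * q) 1 (solve (q ∷ []))
      }
    b₃-combination : (1 + q) * (5 + 6 * q) ≡ (1 + q) * (3 + 2 * q) + (1 + 2 * q) * (2 + 2 * q)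
    b₃-combination = solve (q ∷ [])
    a₄-combination : TH (4 + q * 6) ≡ 0 * ((4 + 3 * q) * (3 + 2 * q)) + 0 * ((4 + 3 * q) * (2 + 2 * q))
                                      + (4 + 6 * q) * ((1 + q) * (5 + 6 * q))
    a₄-combination = TH-by-closed-form (4 + q * 6) (solve (q ∷ []))

consecutiveTH-telescopic-5 : ∀ q → Telescopic (consecutiveTH (5 + q * 6))
consecutiveTH-telescopic-5 q = Equivalence.from (consecutiveTH-telescopic⇔ (5 + q * 6) (s≤s z≤n) F)
  ((0 , 2 + 2 * q , b₃-combination) , (0 , 1 + q , 1 + 2 * q , a₄-combination))
  where
    F : PrefixGcdFactorisation (TH (5 + q * 6 + 3)) (TH (5 + q * 6 + 2)) (TH (5 + q * 6 + 1))
    F = record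
      { b₁ = 10 + 6 * q ; b₂ = 7 + 6 * q ; b₃ = (2 + 2 * q) * (7 + 6 * q) ; e = 3 + 2 * q ; d₃ = 4 + 3 * q
      ; a₁≡ = TH-by-closed-form (5 + q * 6 + 3) (solve (q ∷ []))
      ; a₂≡ = TH-by-closed-form (5 + q * 6 + 2) (solve (q ∷ []))
      ; a₃≡ = TH-by-closed-form (5 + q * 6 + 1) (solve (q ∷ []))
      ; b₁⊥b₂ = Bézout.-+ (16 + 14 * q) (23 + 14 * q) (solve (q ∷ []))
      ; e⊥b₃ = Bézout.-+ (9 + 16 * q + 6 * (q * q)) (2 + q) (solve (q ∷ []))
      }
    b₃-combination : (2 + 2 * q) * (7 + 6 * q) ≡ 0 * (10 + 6 * q) + (2 + 2 * q) * (7 + 6 * q)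
    b₃-combination = refl
    a₄-combination : TH (5 + q * 6) ≡ 0 * ((3 + 2 * q) * (10 + 6 * q)) + (1 + q) * ((3 + 2 * q) * (7 + 6 * q))
                                      + (1 + 2 * q) * ((2 + 2 * q) * (7 + 6 * q))
    a₄-combination = TH-by-closed-form (5 + q * 6) (solve (q ∷ []))

¬consecutiveTH-telescopic-0 : ∀ q → ¬ Telescopic (consecutiveTH (6 + q * 6))
¬consecutiveTH-telescopic-0 q telescopic =
  h*[1+2t]∉ℕ[3+2h]+ℕ[2h] (4 + 3 * q) (3 + 3 * q) (Bézout⇒coprime h⊥3) (n≤1+n (3 + 3 * q))
    (proj₁ (Equivalence.to (consecutiveTH-telescopic⇔ (6 + q * 6) (s≤s z≤n) F) telescopic))
  where
    h⊥3 : Bézout.Identity 1 (4 + 3 * q) 3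
    h⊥3 = Bézout.+- 1 (1 + q) (solve (q ∷ []))
    F : PrefixGcdFactorisation (TH (6 + q * 6 + 3)) (TH (6 + q * 6 + 2)) (TH (6 + q * 6 + 1))
    F = record
      { b₁ = 3 + 2 * (4 + 3 * q) ; b₂ = 2 * (4 + 3 * q) ; b₃ = (4 + 3 * q) * (1 + 2 * (3 + 3 * q))
      ; e = 5 + 3 * q ; d₃ = 3 + 2 * q
      ; a₁≡ = TH-by-closed-form (6 + q * 6 + 3) (solve (q ∷ []))
      ; a₂≡ = TH-by-closed-form (6 + q * 6 + 2) (solve (q ∷ []))
      ; a₃≡ = TH-by-closed-form (6 + q * 6 + 1) (solve (q ∷ []))
      ; b₁⊥b₂ = Bézout.-+ (21 + 16 * q) (29 + 16 * q) (solve (q ∷ []))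
      ; e⊥b₃ = Bézout.-+ (11 + 17 * q + 6 * (q * q)) (2 + q) (solve (q ∷ []))
      }

¬consecutiveTH-telescopic-2 : ∀ q → ¬ Telescopic (consecutiveTH (2 + q * 6))
¬consecutiveTH-telescopic-2 q telescopic =
  h*[1+2t]∉ℕ[3+2h]+ℕ[2h] (2 + 3 * q) q (Bézout⇒coprime h⊥3) (≤-trans (m≤m+n q (2 * q)) (m≤n+m (3 * q) 2))
    (proj₁ (Equivalence.to (consecutiveTH-telescopic⇔ (2 + q * 6) (s≤s z≤n) F) telescopic))
  where
    h⊥3 : Bézout.Identity 1 (2 + 3 * q) 3
    h⊥3 = Bézout.+- 2 (1 + 2 * q) (solve (q ∷ []))
    F : PrefixGcdFactorisation (TH (2 + q * 6 + 3)) (TH (2 + q * 6 + 2)) (TH (2 + q * 6 + 1))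
    F = record
      { b₁ = 3 + 2 * (2 + 3 * q) ; b₂ = 2 * (2 + 3 * q) ; b₃ = (2 + 3 * q) * (1 + 2 * q)
      ; e = 1 + q ; d₃ = 5 + 6 * q
      ; a₁≡ = TH-by-closed-form (2 + q * 6 + 3) (solve (q ∷ []))
      ; a₂≡ = TH-by-closed-form (2 + q * 6 + 2) (solve (q ∷ []))
      ; a₃≡ = TH-by-closed-form (2 + q * 6 + 1) (solve (q ∷ []))
      ; b₁⊥b₂ = Bézout.-+ (17 + 26 * q) (30 + 26 * q) (solve (q ∷ []))
      ; e⊥b₃ = Bézout.-+ (1 + 6 * q) 1 (solve (q ∷ []))
      }

¬consecutiveTH-telescopic-1 : ∀ q → ¬ Telescopic (consecutiveTH (1 + q * 6))
¬consecutiveTH-telescopic-1 q telescopic =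
  ∉ℕ+ℕ+ℕ-by-residue (5 + 6 * q) 2 4 (3 * q) (2 * q) (m∣m*n (2 + 2 * q)) (m∣m*n (1 + 2 * q)) b₃≡
    (divides (1 + q + 6 * (q * q)) (trans (cong (_+ 4) a₄≡) a₄+4≡))
    a₄<[1+b]g₃ (s≤s z≤n) bc+k<M
    (proj₂ (Equivalence.to (consecutiveTH-telescopic⇔ (1 + q * 6) (s≤s z≤n) F) telescopic))
  where
    F : PrefixGcdFactorisation (TH (1 + q * 6 + 3)) (TH (1 + q * 6 + 2)) (TH (1 + q * 6 + 1))
    F = record
      { b₁ = 2 + 2 * q ; b₂ = 1 + 2 * q ; b₃ = (2 + 6 * q) * (1 + 2 * q) ; e = 5 + 6 * q ; d₃ = 2 + 3 * q
      ; a₁≡ = TH-by-closed-form (1 + q * 6 + 3) (solve (q ∷ []))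
      ; a₂≡ = TH-by-closed-form (1 + q * 6 + 2) (solve (q ∷ []))
      ; a₃≡ = TH-by-closed-form (1 + q * 6 + 1) (solve (q ∷ []))
      ; b₁⊥b₂ = Bézout.+- 1 1 (solve (q ∷ []))
      ; e⊥b₃ = Bézout.-+ (1 + 6 * q + 6 * (q * q)) (3 + 3 * q) (solve (q ∷ []))
      }
    a₄≡ : TH (1 + q * 6) ≡ (1 + 6 * q) * (1 + 3 * q) * (1 + 2 * q)
    a₄≡ = TH-by-closed-form (1 + q * 6) (solve (q ∷ []))
    b₃≡ : (2 + 6 * q) * (1 + 2 * q) ≡ 2 + 2 * q * (5 + 6 * q)
    b₃≡ = solve (q ∷ [])
    a₄+4≡ : (1 + 6 * q) * (1 + 3 * q) * (1 + 2 * q) + 4 ≡ (1 + q + 6 * (q * q)) * (5 + 6 * q)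
    a₄+4≡ = solve (q ∷ [])
    gap≡ : (1 + 3 * q) * (1 + 2 * q) + (1 + 6 * q) * (1 + 3 * q) * (1 + 2 * q) ≡ suc (3 * q) * ((2 + 6 * q) * (1 + 2 * q))
    gap≡ = solve (q ∷ [])
    M≡ : suc (3 * q * 2 + 4) ≡ 5 + 6 * q
    M≡ = solve (q ∷ [])
    a₄<[1+b]g₃ : TH (1 + q * 6) < suc (3 * q) * ((2 + 6 * q) * (1 + 2 * q))
    a₄<[1+b]g₃ = subst₂ _<_ (sym a₄≡) gap≡ (m<n+m _ z<s)
    bc+k<M : 3 * q * 2 + 4 < 5 + 6 * q
    bc+k<M = subst (3 * q * 2 + 4 <_) M≡ (n<1+n _)

¬consecutiveTH-telescopic-3 : ∀ q → ¬ Telescopic (consecutiveTH (3 + q * 6))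
¬consecutiveTH-telescopic-3 q telescopic =
  ∉ℕ+ℕ+ℕ-by-residue (7 + 6 * q) 6 4 q (2 + 6 * q) (m∣m*n (8 + 6 * q)) (m∣m*n (5 + 6 * q)) b₃≡
    (divides (2 + 5 * q + 6 * (q * q)) (trans (cong (_+ 4) a₄≡) a₄+4≡))
    a₄<[1+b]g₃ (s≤s z≤n) bc+k<M
    (proj₂ (Equivalence.to (consecutiveTH-telescopic⇔ (3 + q * 6) (s≤s z≤n) F) telescopic))
  where
    F : PrefixGcdFactorisation (TH (3 + q * 6 + 3)) (TH (3 + q * 6 + 2)) (TH (3 + q * 6 + 1))
    F = record
      { b₁ = 8 + 6 * q ; b₂ = 5 + 6 * q ; b₃ = (4 + 6 * q) * (5 + 6 * q) ; e = 7 + 6 * q ; d₃ = 1 + q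
      ; a₁≡ = TH-by-closed-form (3 + q * 6 + 3) (solve (q ∷ []))
      ; a₂≡ = TH-by-closed-form (3 + q * 6 + 2) (solve (q ∷ []))
      ; a₃≡ = TH-by-closed-form (3 + q * 6 + 1) (solve (q ∷ []))
      ; b₁⊥b₂ = Bézout.-+ (18 + 22 * q) (29 + 22 * q) (solve (q ∷ []))
      ; e⊥b₃ = Bézout.-+ (17 + 46 * q + 30 * (q * q)) (6 + 5 * q) (solve (q ∷ []))
      }
    a₄≡ : TH (3 + q * 6) ≡ (1 + 2 * q) * (2 + 3 * q) * (5 + 6 * q)
    a₄≡ = TH-by-closed-form (3 + q * 6) (solve (q ∷ []))
    b₃≡ : (4 + 6 * q) * (5 + 6 * q) ≡ 6 + (2 + 6 * q) * (7 + 6 * q)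
    b₃≡ = solve (q ∷ [])
    a₄+4≡ : (1 + 2 * q) * (2 + 3 * q) * (5 + 6 * q) + 4 ≡ (2 + 5 * q + 6 * (q * q)) * (7 + 6 * q)
    a₄+4≡ = solve (q ∷ [])
    gap≡ : (5 + 6 * q) * (2 + 3 * q) + (1 + 2 * q) * (2 + 3 * q) * (5 + 6 * q) ≡ suc q * ((4 + 6 * q) * (5 + 6 * q))
    gap≡ = solve (q ∷ [])
    M≡ : 3 + (q * 6 + 4) ≡ 7 + 6 * q
    M≡ = solve (q ∷ [])
    a₄<[1+b]g₃ : TH (3 + q * 6) < suc q * ((4 + 6 * q) * (5 + 6 * q))
    a₄<[1+b]g₃ = subst₂ _<_ (sym a₄≡) gap≡ (m<n+m _ {(5 + 6 * q) * (2 + 3 * q)} z<s)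
    bc+k<M : q * 6 + 4 < 7 + 6 * q
    bc+k<M = subst (q * 6 + 4 <_) M≡ (m<n+m (q * 6 + 4) {3} z<s)

[r+q*6]%6≡r : ∀ r q → r < 6 → (r + q * 6) % 6 ≡ r
[r+q*6]%6≡r r q r<6 = trans ([m+kn]%n≡m%n r q 6) (m<n⇒m%n≡m r<6)

[r+q*6]%6∉[4,5] : ∀ r q → r < 4 → ¬ ((r + q * 6) % 6 ≡ 4 ⊎ (r + q * 6) % 6 ≡ 5)
[r+q*6]%6∉[4,5] r q r<4 (inj₁ ≡4) = <⇒≢ r<4 (trans (sym ([r+q*6]%6≡r r q (m≤n⇒m≤n+o 2 r<4))) ≡4)
[r+q*6]%6∉[4,5] r q r<4 (inj₂ ≡5) = <⇒≢ (m<n⇒m<1+n r<4) (trans (sym ([r+q*6]%6≡r r q (m≤n⇒m≤n+o 2 r<4))) ≡5)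

neither : ∀ {A B : Set} → ¬ A → ¬ B → A ⇔ B
neither ¬a ¬b = mk⇔ (λ a → contradiction a ¬a) (λ b → contradiction b ¬b)

consecutiveTH-telescopic⇔residue : ∀ n → 1 ≤ n → DivMod n 6 →
  Telescopic (consecutiveTH n) ⇔ ((n % 6 ≡ 4) ⊎ (n % 6 ≡ 5))
consecutiveTH-telescopic⇔residue _ () (result zero F.zero refl)
consecutiveTH-telescopic⇔residue _ _ (result (suc q) F.zero refl) =
  neither (¬consecutiveTH-telescopic-0 q) ([r+q*6]%6∉[4,5] 0 (suc q) z<s)
consecutiveTH-telescopic⇔residue _ _ (result q (F.suc F.zero) refl) =
  neither (¬consecutiveTH-telescopic-1 q) ([r+q*6]%6∉[4,5] 1 q (s≤s z<s))
consecutiveTH-telescopic⇔residue _ _ (result q (F.suc (F.suc F.zero)) refl) =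
  neither (¬consecutiveTH-telescopic-2 q) ([r+q*6]%6∉[4,5] 2 q (s≤s (s≤s z<s)))
consecutiveTH-telescopic⇔residue _ _ (result q (F.suc (F.suc (F.suc F.zero))) refl) =
  neither (¬consecutiveTH-telescopic-3 q) ([r+q*6]%6∉[4,5] 3 q (s≤s (s≤s (s≤s z<s))))
consecutiveTH-telescopic⇔residue _ _ (result q (F.suc (F.suc (F.suc (F.suc F.zero)))) refl) =
  mk⇔ (λ _ → inj₁ ([m+kn]%n≡m%n 4 q 6)) (λ _ → consecutiveTH-telescopic-4 q)
consecutiveTH-telescopic⇔residue _ _ (result q (F.suc (F.suc (F.suc (F.suc (F.suc F.zero))))) refl) =
  mk⇔ (λ _ → inj₂ ([m+kn]%n≡m%n 5 q 6)) (λ _ → consecutiveTH-telescopic-5 q)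

proposition11 : (n : ℕ) → 1 ≤ n →
    (Telescopic (seq4 (TH (n + 3)) (TH (n + 2)) (TH (n + 1)) (TH n))
      ⇔ ((n % 6 ≡ 4) ⊎ (n % 6 ≡ 5)))
proposition11 n 1≤n = consecutiveTH-telescopic⇔residue n 1≤n (n divMod 6)
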